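{- Let $\Phi$ be a set of formulas each of the form $\Diamond^m p\to\Diamond^n p$ with $n>m>1$. Let $f_i:(W_i,R_i,r_i)\to(W,R,r)$ be a pointed p-morphism, where $(W_i,R_i)$ is a Kripke frame rooted at $r_i$ and $(W,R)$ is a $\mathbf{K}\oplus\Phi$ frame rooted at $r$. Then for every $\Diamond^m p\to\Diamond^n p\in\Phi$ and all $x,z\in W_i$ with $xR_i^m z$: (a) there are $w_1,\dots,w_{n-1}\in W$ and $v_1,\dots,v_{n-1}\in W_i$ such that $f_i(x)Rw_1R\cdots Rw_{n-1}Rf_i(z)$, $xR_iv_1R_i\cdots R_iv_{n-1}$, and $f_i(v_j)=w_j$ for all $j$; and (b) for such $w_j,v_j$ and for distinct points $u_1,\dots,u_{n-1}\notin W_i$, setting $W_{i+1}=W_i\cup\{u_1,\dots,u_{n-1}\}$ and $R_{i+1}=R_i\cup\{(x,u_1),(u_1,u_2),\dots,(u_{n-2},u_{n-1}),(u_{n-1},z)\}\cup\{(u_j,c)\mid 1\le j\le n-1,\ v_jR_ic\}$, the map $f_{i+1}:(W_{i+1},R_{i+1},r_i)\to(W,R,r)$ with $f_{i+1}(y)=f_i(y)$ for $y\in W_i$ and $f_{i+1}(u_j)=w_j$ is a pointed p-morphism, and moreover $\mathrm{d}_{i+1}(u_j)=\mathrm{d}_{i+1}(x)+j$ for each $j\in\{1,\dots,n-1\}$ and $\mathrm{d}_{i+1}(y)=\mathrm{d}_i(y)$ for all $y\in W_i$.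
   Context: $R^0$ is the identity and $R^{k+1}=R^k\circ R$. A frame $(W,R)$ is rooted at $r$ if every point is reachable from $r$ via some $R^k$. A $\mathbf{K}\oplus\Phi$ frame satisfies $\forall x,y\,(xR^my\to xR^ny)$ for each $\Diamond^mp\to\Diamond^np\in\Phi$. A pointed p-morphism $f:(W',R',r')\to(W,R,r)$ is a map with $f(r')=r$, $xR'y\Rightarrow f(x)Rf(y)$, and if $f(x)Ry'$ then there is $y$ with $xR'y$ and $f(y)=y'$. $\mathrm{d}_{i+1}(y)$ is the length of a shortest path from $r_i$ to $y$ in $(W_{i+1},R_{i+1})$, and $\mathrm{d}_i(y)$ the length of a shortest path from $r_i$ to $y$ in $(W_i,R_i)$. -}

module Defs where

open import Data.Nat using (ℕ; zero; suc; _+_; _∸_; _≤_; _<_)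
open import Data.Fin using (Fin; toℕ)
open import Data.Product using (Σ; ∃; _×_; _,_)
open import Data.Sum using (_⊎_; inj₁; inj₂)
open import Relation.Binary.PropositionalEquality using (_≡_)

Rel : Set → Set₁
Rel W = W → W → Set

Pow : {W : Set} → Rel W → ℕ → Rel W
Pow R zero    a b = a ≡ b
Pow R (suc k) a b = ∃ λ c → Pow R k a c × R c b

Rooted : {W : Set} → Rel W → W → Set
Rooted R r = ∀ w → ∃ λ k → Pow R k r w

-- Φ is a set of formulas ◇^m p → ◇^n p, represented by the set of pairs (m , n).
-- A K ⊕ Φ frame satisfies ∀ x y (x R^m y → x R^n y) for each such formula.
KΦFrame : (ℕ → ℕ → Set) → {W : Set} → Rel W → Set
KΦFrame Φ R = ∀ {m n} → Φ m n → ∀ x y → Pow R m x y → Pow R n x y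

PMorph : {W' W : Set} → Rel W' → W' → Rel W → W → (W' → W) → Set
PMorph R' r' R r f =
  (f r' ≡ r)
  × (∀ a b → R' a b → R (f a) (f b))
  × (∀ a b' → R (f a) b' → ∃ λ b → R' a b × f b ≡ b')

IsDist : {W : Set} → Rel W → W → W → ℕ → Set
IsDist R r y d = Pow R d r y × (∀ k → Pow R k r y → d ≤ k)

-- Data (w_1 … w_{n-1}) , (v_1 … v_{n-1}) of part (a), encoded as sequences
-- w , v : ℕ → _ with the conventions w 0 = f x, w n = f z, v 0 = x
-- (values at other indices are irrelevant):
--   f(x) R w_1 R ⋯ R w_{n-1} R f(z),  x R_i v_1 R_i ⋯ R_i v_{n-1},  f(v_j) = w_j.
Lifting : {Wi W : Set} → Rel Wi → Rel W → (Wi → W) → ℕ → Wi → Wi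
          → (ℕ → W) → (ℕ → Wi) → Set
Lifting Ri R f n x z w v =
  (w 0 ≡ f x) × (w n ≡ f z) × (∀ j → j < n → R (w j) (w (suc j)))
  × (v 0 ≡ x) × (∀ j → suc j < n → Ri (v j) (v (suc j)))
  × (∀ j → 1 ≤ j → j < n → f (v j) ≡ w j)

-- W_{i+1} = W_i ∪ {u_1 , … , u_{n-1}} with fresh distinct points u_j;
-- u_j is represented by inj₂ k with k : Fin (n ∸ 1) and j = suc (toℕ k).
Ext : Set → ℕ → Set
Ext Wi n = Wi ⊎ Fin (n ∸ 1)

data ExtRel {Wi : Set} (Ri : Rel Wi) (n : ℕ) (x z : Wi) (v : ℕ → Wi)
     : Ext Wi n → Ext Wi n → Set where
  old : ∀ {a b} → Ri a b → ExtRel Ri n x z v (inj₁ a) (inj₁ b)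
  xu  : (k : Fin (n ∸ 1)) → toℕ k ≡ 0 → ExtRel Ri n x z v (inj₁ x) (inj₂ k)
  uu  : (k l : Fin (n ∸ 1)) → toℕ l ≡ suc (toℕ k)
        → ExtRel Ri n x z v (inj₂ k) (inj₂ l)
  uz  : (k : Fin (n ∸ 1)) → suc (toℕ k) ≡ n ∸ 1
        → ExtRel Ri n x z v (inj₂ k) (inj₁ z)
  uc  : (k : Fin (n ∸ 1)) (c : Wi) → Ri (v (suc (toℕ k))) c
        → ExtRel Ri n x z v (inj₂ k) (inj₁ c)

extMap : {Wi W : Set} (n : ℕ) → (Wi → W) → (ℕ → W) → Ext Wi n → W
extMap n f w (inj₁ y) = f y
extMap n f w (inj₂ k) = w (suc (toℕ k))

-- Part (a): push x R_i^m z forward to f x R^m f z, use the frame condition to get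
-- f x R^n f z, and lift that path step by step through the back condition of f.
-- Part (b): every new edge can be bypassed in W_i without making a path from the
-- root longer.  The edge u_{n-1} R z is replaced by x R_i^m z with m < n, and an edge
-- u_j R c by the old path x R_i v_1 ⋯ R_i v_j R_i c.  So every path from r_i to an old
-- point y has an old shortcut, and every path to u_j passes x at least j steps before
-- its end; together with the new path x R u_1 ⋯ R u_j this determines all distances.
module Submission where

open import Defs
open import Data.Nat using (ℕ; zero; suc; _+_; _∸_; _<_; _≤_; z≤n; s≤s; s≤s⁻¹)
open import Data.Nat.Properties
  using (<⇒≤; n≮0; n≤1+n; +-suc; +-comm; +-identityʳ; +-monoʳ-≤; +-monoˡ-≤; ≤-trans; ≤-antisym; module ≤-Reasoning)
open import Data.Fin using (Fin; toℕ; fromℕ<)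
open import Data.Fin.Properties using (toℕ<n; toℕ-fromℕ<)
open import Data.Product using (∃; _×_; _,_; proj₂; map₂)
open import Data.Sum using (inj₁; inj₂)
open import Data.Empty using (⊥-elim)
open import Function.Bundles using (_⇔_; mk⇔)
open import Relation.Binary.PropositionalEquality

private
  variable
    A B : Set
    i j k m n d s : ℕ

Pow-map : {RA : Rel A} {RB : Rel B} (f : A → B) → (∀ a b → RA a b → RB (f a) (f b)) →
          ∀ {a b} → Pow RA k a b → Pow RB k (f a) (f b)
Pow-map {k = zero}  f hom refl          = refl
Pow-map {k = suc k} f hom (c , p , e) = f c , Pow-map f hom p , hom _ _ e

Pow-++ : {R : Rel A} {a b c : A} → Pow R i a b → Pow R j b c → Pow R (i + j) a c
Pow-++ {i = i} {j = zero}  {R = R} {a} p refl =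
  subst (λ l → Pow R l a _) (sym (+-identityʳ i)) p
Pow-++ {i = i} {j = suc j} {R = R} {a} {c = c} p (b , q , e) =
  subst (λ l → Pow R l a c) (sym (+-suc i j)) (b , Pow-++ p q , e)

Pow-uncons : {R : Rel A} {a b : A} → Pow R (suc k) a b → ∃ λ c → R a c × Pow R k c b
Pow-uncons {k = zero}  (_ , refl , e) = _ , e , refl
Pow-uncons {k = suc k} (c , p , e) with Pow-uncons p
... | c′ , e′ , q = c′ , e′ , (c , q , e)

infixr 5 _◃_
_◃_ : A → (ℕ → A) → ℕ → A
(a ◃ w) zero    = a
(a ◃ w) (suc j) = w j

Pow⇒chain : {R : Rel A} {a b : A} → Pow R k a b →
            ∃ λ (w : ℕ → A) → w 0 ≡ a × w k ≡ b × (∀ j → j < k → R (w j) (w (suc j)))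
Pow⇒chain {k = zero} {a = a} refl = (λ _ → a) , refl , refl , λ _ ()
Pow⇒chain {k = suc k} {R = R} {a = a} p with Pow-uncons p
... | c , e , q with Pow⇒chain q
...   | w , w0 , wk , steps = a ◃ w , refl , wk , steps′
  where
    steps′ : ∀ j → j < suc k → R ((a ◃ w) j) ((a ◃ w) (suc j))
    steps′ zero    _         = subst (R a) (sym w0) e
    steps′ (suc j) (s≤s j<k) = steps j j<k

Pow-prefix : {R : Rel A} (w : ℕ → A) → (∀ j → suc j < k → R (w j) (w (suc j))) →
             ∀ j → j < k → Pow R j (w 0) (w j)
Pow-prefix w steps zero    _   = refl
Pow-prefix w steps (suc j) j<k = w j , Pow-prefix w steps j (<⇒≤ j<k) , steps j j<k

module _ {R′ : Rel A} {R : Rel B} {f : A → B}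
         (back : ∀ a b′ → R (f a) b′ → ∃ λ b → R′ a b × f b ≡ b′) where

  lift-chain : (w : ℕ → B) (a : A) → f a ≡ w 0 → (∀ j → j < k → R (w j) (w (suc j))) →
               ∃ λ (v : ℕ → A) → v 0 ≡ a × (∀ j → j < k → R′ (v j) (v (suc j)))
                                 × (∀ j → j ≤ k → f (v j) ≡ w j)
  lift-chain {k = zero} w a fa≡w0 _ = (λ _ → a) , refl , (λ _ ()) , λ { zero z≤n → fa≡w0 }
  lift-chain {k = suc k} w a fa≡w0 steps
    with back a (w 1) (subst (λ b → R b (w 1)) (sym fa≡w0) (steps 0 (s≤s z≤n)))
  ... | b , e , fb≡w1 with lift-chain (λ j → w (suc j)) b fb≡w1 (λ j j<k → steps (suc j) (s≤s j<k))
  ...   | v , v0 , v-steps , fv = a ◃ v , refl , v-steps′ , fv′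
    where
      v-steps′ : ∀ j → j < suc k → R′ ((a ◃ v) j) ((a ◃ v) (suc j))
      v-steps′ zero    _         = subst (R′ a) (sym v0) e
      v-steps′ (suc j) (s≤s j<k) = v-steps j j<k
      fv′ : ∀ j → j ≤ suc k → f ((a ◃ v) j) ≡ w j
      fv′ zero    _         = fa≡w0
      fv′ (suc j) (s≤s j≤k) = fv j j≤k

lifting-exists : {Φ : ℕ → ℕ → Set} {W Wi : Set} {R : Rel W} {r : W} {Ri : Rel Wi} {ri : Wi}
                 {f : Wi → W} → PMorph Ri ri R r f → KΦFrame Φ R → Φ m n →
                 ∀ {x z} → Pow Ri m x z → ∃ λ w → ∃ λ v → Lifting Ri R f n x z w v
lifting-exists {R = R} {Ri = Ri} {f = f} (_ , forth , back) kΦ φ {x} {z} x↝z =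
  let (w , w0 , wn , w-steps) = Pow⇒chain {R = R} (kΦ φ (f x) (f z) (Pow-map {RA = Ri} f forth x↝z))
      (v , v0 , v-steps , fv) = lift-chain {R′ = Ri} {R = R} back w x (sym w0) w-steps
  in w , v , w0 , wn , w-steps , v0 , (λ j sj<n → v-steps j (<⇒≤ sj<n)) ,
     λ j _ j<n → fv j (<⇒≤ j<n)

-- IsDist R r y is definitionally Least (λ k → Pow R k r y).
Least : (ℕ → Set) → ℕ → Set
Least P d = P d × (∀ k → P k → d ≤ k)

Least-shift : {P Q : ℕ → Set} → Least P d → (∀ {k} → P k → Q (k + s)) →
              (∀ {k} → Q k → ∃ λ k′ → k′ + s ≤ k × P k′) → Least Q (d + s)
Least-shift {s = s} (Pd , least) P⇒Q Q⇒P = P⇒Q Pd , λ k Qk →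
  let (k′ , k′+s≤k , Pk′) = Q⇒P Qk in ≤-trans (+-monoˡ-≤ s (least k′ Pk′)) k′+s≤k

Least-⇔ : {P Q : ℕ → Set} → (∀ {k} → P k → Q k) → (∀ {k} → Q k → ∃ λ k′ → k′ ≤ k × P k′) →
          Least P d ⇔ Least Q d
Least-⇔ {d = d} {P = P} {Q = Q} P⇒Q Q⇒P = mk⇔ to from
  where
    to : Least P d → Least Q d
    to (Pd , least) = P⇒Q Pd , λ k Qk →
      let (k′ , k′≤k , Pk′) = Q⇒P Qk in ≤-trans (least k′ Pk′) k′≤k
    from : Least Q d → Least P d
    from (Qd , least) with Q⇒P Qd
    ... | d′ , d′≤d , Pd′ =
      subst P (≤-antisym d′≤d (least d′ (P⇒Q Pd′))) Pd′ , λ k Pk → least k (P⇒Q Pk)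

-- The paper's n is suc n here, so the new points u_1 … u_n are inj₂ of Fin n.
module Extension {Wi : Set} (Ri : Rel Wi) (n : ℕ) (x z : Wi) (v : ℕ → Wi) where

  R⁺ : Rel (Ext Wi (suc n))
  R⁺ = ExtRel Ri (suc n) x z v

  Pow-old : ∀ {a b} → Pow Ri k a b → Pow R⁺ k (inj₁ a) (inj₁ b)
  Pow-old = Pow-map inj₁ (λ _ _ → old)

  Pow-x-new : ∀ j (u : Fin n) → toℕ u ≡ j → Pow R⁺ (suc j) (inj₁ x) (inj₂ u)
  Pow-x-new zero    u u≡0 = inj₁ x , refl , xu u u≡0
  Pow-x-new (suc j) u u≡  =
    inj₂ u′ , Pow-x-new j u′ (toℕ-fromℕ< j<n) , uu u′ u (trans u≡ (cong suc (sym (toℕ-fromℕ< j<n))))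
    where
      j<n : j < n
      j<n = <⇒≤ (subst (_< n) u≡ (toℕ<n u))
      u′ : Fin n
      u′ = fromℕ< j<n

  Shortcut : Wi → Ext Wi (suc n) → ℕ → Set
  Shortcut a (inj₁ b) k = ∃ λ k′ → k′ ≤ k × Pow Ri k′ a b
  Shortcut a (inj₂ u) k = ∃ λ k′ → k′ + suc (toℕ u) ≤ k × Pow Ri k′ a x

  module _ (m≤n : m ≤ n) (x↝z : Pow Ri m x z)
           (x↝v : ∀ j → j < n → Pow Ri (suc j) x (v (suc j))) where

    shortcut : ∀ {a} e → Pow R⁺ k (inj₁ a) e → Shortcut a e k
    shortcut {k = zero} _ refl = 0 , z≤n , refl
    shortcut {k = suc k} _ (_ , p , old {b} e) with shortcut (inj₁ b) p
    ... | k′ , k′≤k , q = suc k′ , s≤s k′≤k , (b , q , e)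
    shortcut {k = suc k} _ (_ , p , xu u u≡0) with shortcut (inj₁ x) p
    ... | k′ , k′≤k , q = k′ , bound , q
      where
        open ≤-Reasoning
        bound = begin
          k′ + suc (toℕ u) ≡⟨ cong (λ t → k′ + suc t) u≡0 ⟩
          k′ + 1           ≡⟨ +-comm k′ 1 ⟩
          suc k′           ≤⟨ s≤s k′≤k ⟩
          suc k            ∎
    shortcut {k = suc k} _ (_ , p , uu u u′ u′≡) with shortcut (inj₂ u) p
    ... | k′ , k′+u≤k , q = k′ , bound , q
      where
        open ≤-Reasoning
        bound = begin
          k′ + suc (toℕ u′)       ≡⟨ cong (λ t → k′ + suc t) u′≡ ⟩
          k′ + suc (suc (toℕ u))  ≡⟨ +-suc k′ _ ⟩
          suc (k′ + suc (toℕ u))  ≤⟨ s≤s k′+u≤k ⟩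
          suc k                   ∎
    shortcut {k = suc k} _ (_ , p , uz u u≡n) with shortcut (inj₂ u) p
    ... | k′ , k′+u≤k , q = k′ + _ , bound , Pow-++ q x↝z
      where
        open ≤-Reasoning
        bound = begin
          k′ + _           ≤⟨ +-monoʳ-≤ k′ m≤n ⟩
          k′ + n           ≡⟨ cong (k′ +_) (sym u≡n) ⟩
          k′ + suc (toℕ u) ≤⟨ k′+u≤k ⟩
          k                ≤⟨ n≤1+n k ⟩
          suc k            ∎
    shortcut {k = suc k} _ (_ , p , uc u c e) with shortcut (inj₂ u) p
    ... | k′ , k′+u≤k , q = suc (k′ + suc (toℕ u)) , s≤s k′+u≤k ,
                            (_ , Pow-++ q (x↝v (toℕ u) (toℕ<n u)) , e)

    dist-new : ∀ {a} (u : Fin n) d → IsDist R⁺ (inj₁ a) (inj₁ x) d →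
               IsDist R⁺ (inj₁ a) (inj₂ u) (d + suc (toℕ u))
    dist-new u d dist-x =
      Least-shift dist-x (λ p → Pow-++ p (Pow-x-new (toℕ u) u refl))
                         (λ q → map₂ (map₂ Pow-old) (shortcut (inj₂ u) q))

    dist-old : ∀ {a} y d → IsDist Ri a y d ⇔ IsDist R⁺ (inj₁ a) (inj₁ y) d
    dist-old y d = Least-⇔ Pow-old (shortcut (inj₁ y))

  Lifting⇒x↝v : {W : Set} {R : Rel W} {f : Wi → W} {w : ℕ → W} → Lifting Ri R f (suc n) x z w v →
                ∀ j → j < n → Pow Ri (suc j) x (v (suc j))
  Lifting⇒x↝v (_ , _ , _ , v0 , v-steps , _) j j<n =
    subst (λ a → Pow Ri (suc j) a (v (suc j))) v0 (Pow-prefix v v-steps (suc j) (s≤s j<n))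

  extMap-PMorph : {W : Set} {R : Rel W} {r : W} {ri : Wi} {f : Wi → W} {w : ℕ → W} →
                  PMorph Ri ri R r f → Lifting Ri R f (suc n) x z w v →
                  PMorph R⁺ (inj₁ ri) R r (extMap (suc n) f w)
  extMap-PMorph {R = R} {f = f} {w = w} (f-root , forth , back) (w0 , wn , w-steps , _ , _ , fv) =
    f-root , forth⁺ , back⁺
    where
      F : Ext Wi (suc n) → _
      F = extMap (suc n) f w
      step-from : (u : Fin n) → R (w (suc (toℕ u))) (w (suc (suc (toℕ u))))
      step-from u = w-steps (suc (toℕ u)) (s≤s (toℕ<n u))
      f-v : (u : Fin n) → f (v (suc (toℕ u))) ≡ w (suc (toℕ u))
      f-v u = fv (suc (toℕ u)) (s≤s z≤n) (s≤s (toℕ<n u))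
      forth⁺ : ∀ a b → R⁺ a b → R (F a) (F b)
      forth⁺ _ _ (old e)       = forth _ _ e
      forth⁺ _ _ (xu u u≡0)    = subst₂ R w0 (cong (λ t → w (suc t)) (sym u≡0)) (w-steps 0 (s≤s z≤n))
      forth⁺ _ _ (uu u u′ u′≡) = subst (R _) (cong (λ t → w (suc t)) (sym u′≡)) (step-from u)
      forth⁺ _ _ (uz u u≡n)    = subst (R _) (trans (cong (λ t → w (suc t)) u≡n) wn) (step-from u)
      forth⁺ _ _ (uc u c e)    = subst (λ b → R b (f c)) (f-v u) (forth _ _ e)
      back⁺ : ∀ a b′ → R (F a) b′ → ∃ λ b → R⁺ a b × F b ≡ b′
      back⁺ (inj₁ a) b′ e =
        let (b , e′ , fb≡b′) = back a b′ e in inj₁ b , old e′ , fb≡b′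
      back⁺ (inj₂ u) b′ e =
        let (c , e′ , fc≡b′) = back (v (suc (toℕ u))) b′ (subst (λ b → R b b′) (sym (f-v u)) e)
        in inj₁ c , uc u c e′ , fc≡b′

mainTheorem5 :
    (Φ : ℕ → ℕ → Set) → (∀ {m n} → Φ m n → (1 < m) × (m < n)) →
    {W : Set} (R : Rel W) (r : W) → Rooted R r → KΦFrame Φ R →
    {Wi : Set} (Ri : Rel Wi) (ri : Wi) → Rooted Ri ri →
    (fi : Wi → W) → PMorph Ri ri R r fi →
    ∀ {m n} → Φ m n → (x z : Wi) → Pow Ri m x z →
    (∃ λ (w : ℕ → W) → ∃ λ (v : ℕ → Wi) → Lifting Ri R fi n x z w v)
    × (∀ (w : ℕ → W) (v : ℕ → Wi) → Lifting Ri R fi n x z w v →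
        PMorph (ExtRel Ri n x z v) (inj₁ ri) R r (extMap n fi w)
        × (∀ (k : Fin (n ∸ 1)) (d : ℕ) →
             IsDist (ExtRel Ri n x z v) (inj₁ ri) (inj₁ x) d →
             IsDist (ExtRel Ri n x z v) (inj₁ ri) (inj₂ k) (d + suc (toℕ k)))
        × (∀ (y : Wi) (d : ℕ) →
             IsDist Ri ri y d ⇔ IsDist (ExtRel Ri n x z v) (inj₁ ri) (inj₁ y) d))
mainTheorem5 Φ hΦ R r _ kΦ Ri ri _ f pm {n = zero} φ _ _ _ = ⊥-elim (n≮0 (proj₂ (hΦ φ)))
mainTheorem5 Φ hΦ R r _ kΦ Ri ri _ f pm {n = suc n} φ x z x↝z =
  lifting-exists pm kΦ φ x↝z ,
  λ w v lifting →
    let open Extension Ri n x z v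
        m≤n = s≤s⁻¹ (proj₂ (hΦ φ))
        x↝v = Lifting⇒x↝v {R = R} lifting
    in extMap-PMorph {R = R} pm lifting , dist-new m≤n x↝z x↝v , dist-old m≤n x↝z x↝v
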